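{- For any graph $G$, we have $\mathrm{scw}(G)=1$ if and only if $G$ is a tree. For a simple graph $G$ on $n$ vertices, we have $\mathrm{scw}(G)=n-1$ if and only if $G=K_n$.
   Context: All graphs are finite connected multigraphs (multiple edges allowed, no loops); simple means no multiple edges. $K_n$ is the complete simple graph on $n$ vertices. Screewidth: a tree-cut decomposition of $G$ is a pair $(T,\mathcal{X})$ with $T$ a tree (vertices = nodes, edges = links) and $\mathcal{X}=\{X_b: b\in V(T)\}$ pairwise disjoint, possibly empty subsets of $V(G)$ (bags) with union $V(G)$. For a link $l$, $\mathrm{adh}(l)$ is the set of edges of $G$ with endpoints in bags $X_b,X_d$ where $b,d$ lie in different components of $T-l$; for a node $b$, $\mathrm{adh}(b)$ is the set of edges of $G$ with endpoints in bags $X_c,X_d$ where $c,d$ lie in different components of $T-b$. The width is $\max\{\max_l|\mathrm{adh}(l)|,\ \max_b(|X_b|+|\mathrm{adh}(b)|)\}$, and $\mathrm{scw}(G)$ is the minimum width over all tree-cut decompositions of $G$. -}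

module Defs where

open import Data.Nat using (ℕ; zero; suc; _+_; _≤_)
open import Data.Fin using (Fin; zero; suc; inject₁; fromℕ)
open import Data.Product using (Σ; ∃; _×_; _,_; proj₁; proj₂)
open import Data.Sum using (_⊎_)
open import Data.Unit using (⊤)
open import Data.List using (List; length)
open import Data.List.Relation.Unary.All using (All)
open import Data.List.Relation.Unary.Unique.Propositional using (Unique)
open import Relation.Binary.PropositionalEquality using (_≡_; _≢_)
open import Relation.Nullary using (¬_)

-- Parallel edges are allowed (distinct edge indices with same ends).

record MultiGraph : Set where
  field
    n        : ℕ
    m        : ℕ
    ends     : Fin m → Fin n × Fin n
    loopless : ∀ e → proj₁ (ends e) ≢ proj₂ (ends e)

open MultiGraph public

Joins : (G : MultiGraph) → Fin (m G) → Fin (n G) → Fin (n G) → Set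
Joins G e x y = (ends G e ≡ (x , y)) ⊎ (ends G e ≡ (y , x))

-- Reachability using only edges satisfying okE and vertices satisfying okV
-- (i.e. reachability in a subgraph such as G - e or G - v).
data Reach (G : MultiGraph) (okE : Fin (m G) → Set) (okV : Fin (n G) → Set)
     : Fin (n G) → Fin (n G) → Set where
  here : ∀ {x} → okV x → Reach G okE okV x x
  step : ∀ {x y z} (e : Fin (m G)) → Reach G okE okV x y → okE e →
         Joins G e y z → okV z → Reach G okE okV x z

AllE : (G : MultiGraph) → Fin (m G) → Set
AllE G _ = ⊤

AllV : (G : MultiGraph) → Fin (n G) → Set
AllV G _ = ⊤

Connected : MultiGraph → Set
Connected G = (1 ≤ n G) × (∀ u v → Reach G (AllE G) (AllV G) u v)

-- A cycle of length k+2 (k+2 ≥ 2): pairwise distinct vertices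
-- v_0,…,v_{k+1}, pairwise distinct edges e_0,…,e_{k+1}, e_i joins v_i and
-- v_{i+1}, and e_{k+1} joins v_{k+1} and v_0.  (Length 2 = two parallel edges.)
record Cycle (G : MultiGraph) : Set where
  field
    len     : ℕ
    vs      : Fin (suc (suc len)) → Fin (n G)
    es      : Fin (suc (suc len)) → Fin (m G)
    vs-inj  : ∀ i j → vs i ≡ vs j → i ≡ j
    es-inj  : ∀ i j → es i ≡ es j → i ≡ j
    joins   : ∀ (i : Fin (suc len)) →
              Joins G (es (inject₁ i)) (vs (inject₁ i)) (vs (suc i))
    closing : Joins G (es (fromℕ (suc len))) (vs (fromℕ (suc len))) (vs zero)

Acyclic : MultiGraph → Set
Acyclic G = ¬ Cycle G

IsTree : MultiGraph → Set
IsTree G = Connected G × Acyclic G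

Simple : MultiGraph → Set
Simple G = ∀ e e' x y → Joins G e x y → Joins G e' x y → e ≡ e'

-- complete: every two distinct vertices are adjacent
-- (a simple complete graph on the vertex set Fin n is K_n)
IsComplete : MultiGraph → Set
IsComplete G = ∀ u v → u ≢ v → ∃ λ e → Joins G e u v

-- Tree-cut decompositions.  The bags X_b (pairwise disjoint, possibly
-- empty, covering V(G)) are given by the map  bag : V(G) → V(T),
-- X_b = { v | bag v ≡ b }.

record TCD (G : MultiGraph) : Set where
  field
    T      : MultiGraph
    T-tree : IsTree T
    bag    : Fin (n G) → Fin (n T)

open TCD public

InAdhLink : {G : MultiGraph} (D : TCD G) → Fin (m (T D)) → Fin (m G) → Set
InAdhLink {G} D l e =
  ¬ Reach (T D) (λ l' → l' ≢ l) (AllV (T D))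
          (bag D (proj₁ (ends G e))) (bag D (proj₂ (ends G e)))

InAdhNode : {G : MultiGraph} (D : TCD G) → Fin (n (T D)) → Fin (m G) → Set
InAdhNode {G} D b e =
  (bag D (proj₁ (ends G e)) ≢ b) × (bag D (proj₂ (ends G e)) ≢ b) ×
  ¬ Reach (T D) (AllE (T D)) (λ c → c ≢ b)
          (bag D (proj₁ (ends G e))) (bag D (proj₂ (ends G e)))

-- width of D is at most k:
--   |adh(l)| ≤ k for every link l, and |X_b| + |adh(b)| ≤ k for every node b.
-- Cardinality bounds are expressed via duplicate-free lists of members.
WidthLE : {G : MultiGraph} → TCD G → ℕ → Set
WidthLE {G} D k =
  (∀ (l : Fin (m (T D))) (es : List (Fin (m G))) →
     Unique es → All (InAdhLink D l) es → length es ≤ k) ×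
  (∀ (b : Fin (n (T D))) (vs : List (Fin (n G))) (es : List (Fin (m G))) →
     Unique vs → All (λ v → bag D v ≡ b) vs →
     Unique es → All (InAdhNode D b) es →
     length vs + length es ≤ k)

IsScw : MultiGraph → ℕ → Set
IsScw G k =
  (Σ (TCD G) λ D → WidthLE D k) ×
  (∀ (D : TCD G) (j : ℕ) → WidthLE D j → k ≤ j)

{-# OPTIONS --safe #-}
-- A tree is its own tree-cut decomposition of width 1: an edge lies only in the adhesion of
-- its own link, and node adhesions are empty.  Conversely, in a decomposition of width 1 the
-- first two vertices of a cycle lie in different bags, which some link l separates; the
-- first cycle edge then crosses l, so no other one does, and the rest of the cycle joins the
-- two bags in T − l.
--
-- For a simple graph on n ≥ 2 vertices, the bags {u}, V ∖ {u, v}, {v} on a path of three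
-- nodes give width at most n − 1, and at most n − 2 if n ≥ 3 and u, v are not adjacent.  For
-- K_n nothing better exists: either one bag holds all vertices, or a link l separates the
-- bags of some u and v, and every w ≠ u has an edge to u or to v crossing l, giving n − 1
-- distinct edges in adh(l).
--
-- Adhesion is not decidable, so these separation arguments run in the double-negation
-- monad; their conclusions are ⊥ or decidable.

module Submission where

open import Defs
open import Level using (0ℓ)
open import Effect.Monad using (RawMonad)
open import Data.Nat using (ℕ; zero; suc; _+_; _≤_; _∸_; z≤n; s≤s; _≤?_)
open import Data.Nat.Properties
  using (≤-trans; +-mono-≤; +-comm; +-identityʳ; m∸n≤m; ∸-monoˡ-≤; ∸-monoʳ-<; m<n⇒0<n∸m;
         <⇒≱; 1+n≰n)
open import Data.Fin using (Fin; zero; suc; inject₁; fromℕ; fromℕ<; punchIn; _≟_)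
open import Data.Fin.Properties
  using (punchIn-injective; punchInᵢ≢i; inject₁-injective; fromℕ≢inject₁; fromℕ<-injective;
         injective⇒≤; all?; any?; ¬∀⟶∃¬)
open import Data.Vec.Functional using () renaming (_∷_ to _◂_)
open import Data.Product using (Σ; ∃; _×_; _,_; proj₁; proj₂)
open import Data.Product.Properties using (≡-dec)
open import Data.Sum using (_⊎_; inj₁; inj₂; [_,_])
open import Data.Unit using (⊤; tt)
open import Data.Empty using (⊥; ⊥-elim)
open import Data.List using (List; []; _∷_; length; lookup; tabulate)
open import Data.List.Properties using (length-tabulate)
open import Data.List.Membership.Propositional.Properties using (∈-lookup)
open import Data.List.Relation.Unary.All as All using (All; []; _∷_)
import Data.List.Relation.Unary.All.Properties as AllP
open import Data.List.Relation.Unary.AllPairs using ([]; _∷_)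
open import Data.List.Relation.Unary.Unique.Propositional using (Unique)
import Data.List.Relation.Unary.Unique.Propositional.Properties as UniqueP
open import Function using (_∘_; id; case_of_)
open import Function.Bundles using (_⇔_; mk⇔)
open import Function.Definitions using (Injective)
open import Relation.Binary.PropositionalEquality using (_≡_; _≢_; refl; sym; trans; cong; cong₂; subst)
open import Relation.Nullary using (¬_; Dec; yes; no; ¬¬-map)
open import Relation.Nullary.Decidable using (_⊎-dec_; decidable-stable)
open import Relation.Nullary.Negation using (¬¬-Monad)

open RawMonad (¬¬-Monad {0ℓ}) using (_>>=_; pure)

Adjacent : (G : MultiGraph) → Fin (n G) → Fin (n G) → Set
Adjacent G x y = ∃ λ e → Joins G e x y

Incident : (G : MultiGraph) → Fin (n G) → Fin (m G) → Set
Incident G x e = ∃ λ y → Joins G e x y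

module _ {G : MultiGraph} where

  joins-sym : ∀ {e x y} → Joins G e x y → Joins G e y x
  joins-sym (inj₁ p) = inj₂ p
  joins-sym (inj₂ p) = inj₁ p

  joins-irrefl : ∀ {e x y} → Joins G e x y → x ≢ y
  joins-irrefl {e} (inj₁ p) x≡y = loopless G e (trans (cong proj₁ p) (trans x≡y (sym (cong proj₂ p))))
  joins-irrefl {e} (inj₂ p) x≡y = loopless G e (trans (cong proj₁ p) (trans (sym x≡y) (sym (cong proj₂ p))))

  joins-end : ∀ {e x y a b} → Joins G e x y → Joins G e a b → x ≡ a ⊎ x ≡ b
  joins-end (inj₁ p) (inj₁ q) = inj₁ (cong proj₁ (trans (sym p) q))
  joins-end (inj₁ p) (inj₂ q) = inj₂ (cong proj₁ (trans (sym p) q))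
  joins-end (inj₂ p) (inj₁ q) = inj₂ (cong proj₂ (trans (sym p) q))
  joins-end (inj₂ p) (inj₂ q) = inj₁ (cong proj₂ (trans (sym p) q))

  endpoint⇒incident : ∀ {e x} → proj₁ (ends G e) ≡ x ⊎ proj₂ (ends G e) ≡ x → Incident G x e
  endpoint⇒incident {e} (inj₁ p) = proj₂ (ends G e) , inj₁ (cong (_, proj₂ (ends G e)) p)
  endpoint⇒incident {e} (inj₂ p) = proj₁ (ends G e) , inj₂ (cong (proj₁ (ends G e) ,_) p)

joins? : ∀ G e x y → Dec (Joins G e x y)
joins? G e x y = ≡-dec _≟_ _≟_ (ends G e) (x , y) ⊎-dec ≡-dec _≟_ _≟_ (ends G e) (y , x)

adjacent-sym : ∀ {G x y} → Adjacent G x y → Adjacent G y x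
adjacent-sym {G} (e , j) = e , joins-sym {G} j

adjacent⇒≢ : ∀ {G x y} → Adjacent G x y → y ≢ x
adjacent⇒≢ {G} (_ , j) = joins-irrefl {G} j ∘ sym

adjacent? : ∀ G x y → Dec (Adjacent G x y)
adjacent? G x y = any? λ e → joins? G e x y

module _ {G : MultiGraph} {okE : Fin (m G) → Set} {okV : Fin (n G) → Set} where

  reach-end : ∀ {x z} → Reach G okE okV x z → okV z
  reach-end (here ok) = ok
  reach-end (step _ _ _ _ ok) = ok

  reach-trans : ∀ {x y z} → Reach G okE okV x y → Reach G okE okV y z → Reach G okE okV x z
  reach-trans r (here _) = r
  reach-trans r (step e s ok j okz) = step e (reach-trans r s) ok j okz

  reach-edge : ∀ {e x y} → okE e → Joins G e x y → okV x → okV y → Reach G okE okV x y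
  reach-edge {e} ok j okx oky = step e (here okx) ok j oky

  reach-sym : ∀ {x z} → Reach G okE okV x z → Reach G okE okV z x
  reach-sym (here ok) = here ok
  reach-sym (step e r ok j okz) = reach-trans (reach-edge ok (joins-sym {G} j) okz (reach-end r)) (reach-sym r)

data Path (G : MultiGraph) (okE : Fin (m G) → Set) : ℕ → Fin (n G) → Fin (n G) → Set where
  nil  : ∀ {x} → Path G okE 0 x x
  cons : ∀ {k x y z} (f : Fin (m G)) → okE f → Joins G f x y → Path G okE k y z → Path G okE (suc k) x z

◂-injective : ∀ {A : Set} {k} {x : A} {f : Fin k → A} →
              Injective _≡_ _≡_ f → (∀ i → f i ≢ x) → Injective _≡_ _≡_ (x ◂ f)
◂-injective _     _   {zero}  {zero}  _  = refl
◂-injective _     f≢x {zero}  {suc j} eq = ⊥-elim (f≢x j (sym eq))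
◂-injective _     f≢x {suc i} {zero}  eq = ⊥-elim (f≢x i eq)
◂-injective f-inj _   {suc i} {suc j} eq = cong suc (f-inj eq)

module _ {G : MultiGraph} {okE : Fin (m G) → Set} where

  vertex : ∀ {k x z} → Path G okE k x z → Fin (suc k) → Fin (n G)
  vertex {x = x} _ zero    = x
  vertex (cons _ _ _ p) (suc i) = vertex p i

  edge : ∀ {k x z} → Path G okE k x z → Fin k → Fin (m G)
  edge (cons f _ _ _) zero    = f
  edge (cons _ _ _ p) (suc i) = edge p i

  vertex-last : ∀ {k x z} (p : Path G okE k x z) → vertex p (fromℕ k) ≡ z
  vertex-last nil            = refl
  vertex-last (cons _ _ _ p) = vertex-last p

  edge-joins : ∀ {k x z} (p : Path G okE k x z) i → Joins G (edge p i) (vertex p (inject₁ i)) (vertex p (suc i))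
  edge-joins (cons _ _ j _) zero    = j
  edge-joins (cons _ _ _ p) (suc i) = edge-joins p i

  edge-ok : ∀ {k x z} (p : Path G okE k x z) i → okE (edge p i)
  edge-ok (cons _ ok _ _) zero    = ok
  edge-ok (cons _ _ _ p)  (suc i) = edge-ok p i

  Fresh : ∀ {k x z} → Fin (n G) → Path G okE k x z → Set
  Fresh w p = ∀ i → vertex p i ≢ w

  SelfAvoiding : ∀ {k x z} → Path G okE k x z → Set
  SelfAvoiding nil                      = ⊤
  SelfAvoiding (cons {x = x} _ _ _ p) = Fresh x p × SelfAvoiding p

  vertex-injective : ∀ {k x z} (p : Path G okE k x z) → SelfAvoiding p → Injective _≡_ _≡_ (vertex p)
  vertex-injective nil            _           {zero} {zero} _ = refl
  vertex-injective (cons _ _ _ _) _            {zero}  {zero}  _  = refl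
  vertex-injective (cons _ _ _ _) (fresh , _)  {zero}  {suc j} eq = ⊥-elim (fresh j (sym eq))
  vertex-injective (cons _ _ _ _) (fresh , _)  {suc i} {zero}  eq = ⊥-elim (fresh i eq)
  vertex-injective (cons _ _ _ p) (_ , sa)     {suc i} {suc j} eq = cong suc (vertex-injective p sa eq)

  edge-injective : ∀ {k x z} (p : Path G okE k x z) → SelfAvoiding p → Injective _≡_ _≡_ (edge p)
  edge-injective (cons _ _ _ _) _ {zero} {zero} _ = refl
  edge-injective (cons _ _ j p) (fresh , _) {zero} {suc i} eq =
    ⊥-elim ([ fresh (inject₁ i) ∘ sym , fresh (suc i) ∘ sym ]
              (joins-end {G} j (subst (λ f → Joins G f _ _) (sym eq) (edge-joins p i))))
  edge-injective p@(cons _ _ _ _) sa {suc i} {zero} eq = sym (edge-injective p sa (sym eq))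
  edge-injective (cons _ _ _ p) (_ , sa) {suc i} {suc j} eq = cong suc (edge-injective p sa eq)

SelfAvoidingPath : (G : MultiGraph) → (Fin (m G) → Set) → Fin (n G) → Fin (n G) → Set
SelfAvoidingPath G okE x z = Σ ℕ λ k → Σ (Path G okE k x z) SelfAvoiding

module _ {G : MultiGraph} {okE : Fin (m G) → Set} where

  shortcut : ∀ {k y z} (w : Fin (n G)) (p : Path G okE k y z) → SelfAvoiding p →
             Fresh w p ⊎ SelfAvoidingPath G okE w z
  shortcut w (nil {y}) _ with y ≟ w
  ... | yes refl = inj₂ (0 , nil , _)
  ... | no y≢w   = inj₁ λ { zero → y≢w }
  shortcut w p@(cons {x = y} _ _ _ q) sa@(_ , sa-q) with y ≟ w
  ... | yes refl = inj₂ (_ , p , sa)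
  ... | no y≢w with shortcut w q sa-q
  ...   | inj₁ fresh = inj₁ λ { zero → y≢w ; (suc i) → fresh i }
  ...   | inj₂ tail  = inj₂ tail

  eraseLoops : ∀ {k x z} → Path G okE k x z → SelfAvoidingPath G okE x z
  eraseLoops nil = 0 , nil , _
  eraseLoops (cons {x = x} f ok j p) with eraseLoops p
  ... | _ , q , sa with shortcut x q sa
  ...   | inj₁ fresh = _ , cons f ok j q , fresh , sa
  ...   | inj₂ tail  = tail

  path⇒reach : ∀ {k x z} {Q : Fin (m G) → Set} (p : Path G okE k x z) → (∀ i → Q (edge p i)) →
               Reach G Q (AllV G) x z
  path⇒reach nil            _  = here tt
  path⇒reach (cons _ _ j p) ok = reach-trans (reach-edge (ok zero) j tt tt) (path⇒reach p (ok ∘ suc))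

  reach⇒reversePath : ∀ {okV x z} → Reach G okE okV x z → ∃ λ k → Path G okE k z x
  reach⇒reversePath (here _) = 0 , nil
  reach⇒reversePath (step e r ok j _) with reach⇒reversePath r
  ... | k , p = suc k , cons e ok (joins-sym {G} j) p

closeCycle : ∀ {G e y q k} (p : Path G (_≢ e) (suc k) q y) → SelfAvoiding p → Joins G e y q → Cycle G
closeCycle {G} {e} {y} {q} {k} p sa e-joins = record
  { len     = k
  ; vs      = y ◂ (vertex p ∘ inject₁)
  ; es      = e ◂ edge p
  ; vs-inj  = λ _ _ → ◂-injective (inject₁-injective ∘ vertex-injective p sa) y-last
  ; es-inj  = λ _ _ → ◂-injective (edge-injective p sa) (edge-ok p)
  ; joins   = λ { zero → e-joins ; (suc i) → edge-joins p (inject₁ i) }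
  ; closing = subst (Joins G (edge p (fromℕ k)) (vertex p (inject₁ (fromℕ k))))
                    (vertex-last p) (edge-joins p (fromℕ k))
  }
  where
  y-last : ∀ i → vertex p (inject₁ i) ≢ y
  y-last i eq = fromℕ≢inject₁ {i = i} (vertex-injective p sa (trans (vertex-last p) (sym eq)))

tree-edge-is-bridge : ∀ {T e y q} → IsTree T → Joins T e y q → ¬ Reach T (_≢ e) (AllV T) y q
tree-edge-is-bridge {T} tree e-joins r with reach⇒reversePath r
... | _ , p with eraseLoops p
...   | 0     , nil , _  = joins-irrefl {T} e-joins refl
...   | suc _ , p′  , sa = proj₂ tree (closeCycle p′ sa e-joins)

tree-separating-link : ∀ {T x y} → IsTree T → x ≢ y → ∃ λ l → ¬ Reach T (_≢ l) (AllV T) x y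
tree-separating-link {T} {x} {y} tree x≢y with reach⇒reversePath (proj₂ (proj₁ tree) x y)
... | _ , p with eraseLoops p
...   | 0 , nil , _ = ⊥-elim (x≢y refl)
...   | suc _ , p′@(cons f _ f-joins rest) , sa =
  f , λ r → tree-edge-is-bridge tree (joins-sym {T} f-joins) (reach-trans (path⇒reach rest rest-avoids-f) r)
  where
  rest-avoids-f : ∀ i → edge rest i ≢ f
  rest-avoids-f i eq with edge-injective p′ sa {suc i} {zero} eq
  ... | ()

lookup-injective : ∀ {A : Set} {xs : List A} → Unique xs → Injective _≡_ _≡_ (lookup xs)
lookup-injective (_ ∷ _)    {zero}  {zero}  _  = refl
lookup-injective (x∉ ∷ _)   {zero}  {suc j} eq = ⊥-elim (All.lookup x∉ (∈-lookup j) eq)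
lookup-injective (x∉ ∷ _)   {suc i} {zero}  eq = ⊥-elim (All.lookup x∉ (∈-lookup i) (sym eq))
lookup-injective (_ ∷ uxs)  {suc i} {suc j} eq = cong suc (lookup-injective uxs eq)

length-unique≤ : ∀ {N} {xs : List (Fin N)} → Unique xs → length xs ≤ N
length-unique≤ uxs = injective⇒≤ (lookup-injective uxs)

length-unique-avoiding≤ : ∀ {N} {u : Fin N} {xs} → Unique xs → All (_≢ u) xs → length xs ≤ N ∸ 1
length-unique-avoiding≤ uxs ≢u = ∸-monoˡ-≤ 1 (length-unique≤ (All.map (_∘ sym) ≢u ∷ uxs))

length-unique-avoiding₂≤ : ∀ {N} {u v : Fin N} {xs} → u ≢ v →
                           Unique xs → All (_≢ u) xs → All (_≢ v) xs → length xs ≤ N ∸ 2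
length-unique-avoiding₂≤ u≢v uxs ≢u ≢v =
  ∸-monoˡ-≤ 2 (length-unique≤ ((u≢v ∷ All.map (_∘ sym) ≢u) ∷ All.map (_∘ sym) ≢v ∷ uxs))

length-unique-subsingleton≤1 : ∀ {A : Set} {P : A → Set} → (∀ {x y} → P x → P y → x ≡ y) →
                               ∀ {xs} → Unique xs → All P xs → length xs ≤ 1
length-unique-subsingleton≤1 _    {[]}         _                 _              = z≤n
length-unique-subsingleton≤1 _    {_ ∷ []}     _                 _              = s≤s z≤n
length-unique-subsingleton≤1 same {_ ∷ _ ∷ _} ((x≢y ∷ _) ∷ _) (px ∷ py ∷ _) = ⊥-elim (x≢y (same px py))

all-absurd⇒[] : ∀ {A : Set} {P : A → Set} {xs} → (∀ {x} → ¬ P x) → All P xs → xs ≡ []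
all-absurd⇒[] _  []      = refl
all-absurd⇒[] ¬p (p ∷ _) = ⊥-elim (¬p p)

≤-+[] : ∀ {A B : Set} {xs : List A} {ys : List B} {K} → length xs ≤ K → ys ≡ [] → length xs + length ys ≤ K
≤-+[] xs≤K refl = subst (_≤ _) (sym (+-identityʳ _)) xs≤K

at-most-two-elements : ∀ {N} → ¬ 3 ≤ N → {a b c : Fin N} → a ≢ c → b ≢ c → a ≡ b
at-most-two-elements 3≰N {a} {b} a≢c b≢c with a ≟ b
... | yes a≡b = a≡b
... | no a≢b  = ⊥-elim (3≰N (length-unique≤ ((a≢b ∷ a≢c ∷ []) ∷ (b≢c ∷ []) ∷ [] ∷ [])))

allFinExcept : ∀ {N} (u : Fin N) → Σ (List (Fin N)) λ ws → Unique ws × All (_≢ u) ws × length ws ≡ N ∸ 1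
allFinExcept {suc _} u =
  tabulate (punchIn u) , UniqueP.tabulate⁺ (punchIn-injective u _ _) ,
  AllP.tabulate⁺ (punchInᵢ≢i u) , length-tabulate (punchIn u)

module _ {A B : Set} {P : A → Set} (f : ∀ {x} → P x → B) where

  length-reduce : ∀ {xs} (pxs : All P xs) → length (All.reduce f pxs) ≡ length xs
  length-reduce []         = refl
  length-reduce (_ ∷ pxs) = cong suc (length-reduce pxs)

  reduce-All : ∀ {Q : B → Set} → (∀ {x} (px : P x) → Q (f px)) →
               ∀ {xs} (pxs : All P xs) → All Q (All.reduce f pxs)
  reduce-All q []         = []
  reduce-All q (px ∷ pxs) = q px ∷ reduce-All q pxs

  reduce-unique : (∀ {x y} (px : P x) (py : P y) → f px ≡ f py → x ≡ y) →
                  ∀ {xs} → Unique xs → (pxs : All P xs) → Unique (All.reduce f pxs)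
  reduce-unique f-inj []           []          = []
  reduce-unique f-inj (x∉ ∷ uxs) (px ∷ pxs) = head-fresh x∉ pxs ∷ reduce-unique f-inj uxs pxs
    where
    head-fresh : ∀ {x ys} {px : P x} → All (x ≢_) ys → (pys : All P ys) → All (f px ≢_) (All.reduce f pys)
    head-fresh []           []          = []
    head-fresh (x≢y ∷ x∉) (py ∷ pys) = (x≢y ∘ f-inj _ py) ∷ head-fresh x∉ pys

¬¬-chain : ∀ {A : Set} (R : A → A → Set) → (∀ {a} → R a a) → (∀ {a b c} → R a b → R b c → R a c) →
           ∀ k (w : Fin (suc k) → A) → (∀ i → ¬ ¬ R (w (inject₁ i)) (w (suc i))) →
           ¬ ¬ R (w zero) (w (fromℕ k))
¬¬-chain R R-refl R-trans zero    w steps = pure R-refl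
¬¬-chain R R-refl R-trans (suc k) w steps = do
  r₀ ← steps zero
  r  ← ¬¬-chain R R-refl R-trans k (w ∘ suc) (steps ∘ suc)
  pure (R-trans r₀ r)

-- Tree-cut decompositions

module _ {G : MultiGraph} (D : TCD G) where

  SameSide : Fin (m (T D)) → Fin (n G) → Fin (n G) → Set
  SameSide l a b = Reach (T D) (_≢ l) (AllV (T D)) (bag D a) (bag D b)

  joins-across⇒adhesion : ∀ {l e a b} → Joins G e a b → ¬ SameSide l a b → InAdhLink D l e
  joins-across⇒adhesion (inj₁ p) ¬same rewrite p = ¬same
  joins-across⇒adhesion (inj₂ p) ¬same rewrite p = ¬same ∘ reach-sym

  ¬adhesion⇒¬¬sameSide : ∀ {l e a b} → Joins G e a b → ¬ InAdhLink D l e → ¬ ¬ SameSide l a b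
  ¬adhesion⇒¬¬sameSide e-joins ¬adh ¬same = ¬adh (joins-across⇒adhesion e-joins ¬same)

  bag-size≤width : ∀ {K b vs} → WidthLE D K → Unique vs → All (λ v → bag D v ≡ b) vs → length vs ≤ K
  bag-size≤width {b = b} {vs} W uvs in-b = subst (_≤ _) (+-identityʳ _) (proj₂ W b vs [] uvs in-b [] [])

width≥1 : ∀ {G} (D : TCD G) → Fin (n G) → ∀ {K} → WidthLE D K → 1 ≤ K
width≥1 D u W = bag-size≤width D {vs = u ∷ []} W ([] ∷ []) (refl ∷ [])

module _ {G : MultiGraph} (tree : IsTree G) where

  treeDecomposition : TCD G
  treeDecomposition = record { T = G ; T-tree = tree ; bag = id }

  treeDecomposition-width : WidthLE treeDecomposition 1
  treeDecomposition-width = links , nodes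
    where
    adhesion⇒≡ : ∀ {l e} → InAdhLink treeDecomposition l e → e ≡ l
    adhesion⇒≡ {l} {e} adh with e ≟ l
    ... | yes e≡l = e≡l
    ... | no e≢l  = ⊥-elim (adh (reach-edge e≢l (inj₁ refl) tt tt))

    ¬node-adhesion : ∀ {b e} → ¬ InAdhNode treeDecomposition b e
    ¬node-adhesion (a≢b , c≢b , ¬r) = ¬r (reach-edge tt (inj₁ refl) a≢b c≢b)

    links : ∀ l es → Unique es → All (InAdhLink treeDecomposition l) es → length es ≤ 1
    links l es ues adh =
      length-unique-subsingleton≤1 (λ e≡l e′≡l → trans e≡l (sym e′≡l)) ues (All.map adhesion⇒≡ adh)

    nodes : ∀ b vs es → Unique vs → All (λ v → v ≡ b) vs →
            Unique es → All (InAdhNode treeDecomposition b) es → length vs + length es ≤ 1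
    nodes b vs es uvs in-b _ adh =
      ≤-+[] {xs = vs} (length-unique-subsingleton≤1 (λ v≡b w≡b → trans v≡b (sym w≡b)) uvs in-b)
                      (all-absurd⇒[] ¬node-adhesion adh)

width≤1⇒acyclic : ∀ {G} (D : TCD G) → WidthLE D 1 → Acyclic G
width≤1⇒acyclic {G} D W cycle = case bag D (vs zero) ≟ bag D (vs (suc zero)) of λ where
    (yes same-bag) → 1+n≰n (bag-size≤width D W ((v₀≢v₁ ∷ []) ∷ [] ∷ []) (refl ∷ sym same-bag ∷ []))
    (no different-bags) → let l , ¬same = tree-separating-link (T-tree D) different-bags in
                          separated l ¬same
  where
  open Cycle cycle

  v₀≢v₁ : vs zero ≢ vs (suc zero)
  v₀≢v₁ eq with vs-inj zero (suc zero) eq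
  ... | ()

  separated : ∀ l → ¬ SameSide D l (vs zero) (vs (suc zero)) → ⊥
  separated l ¬same = around-the-cycle (¬same ∘ reach-sym)
    where
    first : InAdhLink D l (es zero)
    first = joins-across⇒adhesion D (joins zero) ¬same

    only-first : ∀ j → ¬ InAdhLink D l (es (suc j))
    only-first j adh =
      1+n≰n (proj₁ W l (es zero ∷ es (suc j) ∷ []) ((e₀≢eⱼ ∷ []) ∷ [] ∷ []) (first ∷ adh ∷ []))
      where
      e₀≢eⱼ : es zero ≢ es (suc j)
      e₀≢eⱼ eq with es-inj zero (suc j) eq
      ... | ()

    around-the-cycle : ¬ ¬ SameSide D l (vs (suc zero)) (vs zero)
    around-the-cycle = do
      r₁ ← ¬¬-chain (SameSide D l) (here tt) reach-trans len (vs ∘ suc)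
             (λ i → ¬adhesion⇒¬¬sameSide D (joins (suc i)) (only-first (inject₁ i)))
      r₂ ← ¬adhesion⇒¬¬sameSide D closing (only-first (fromℕ len))
      pure (reach-trans r₁ r₂)

scw≡1⇔tree : ∀ (G : MultiGraph) → Connected G → (IsScw G 1 ⇔ IsTree G)
scw≡1⇔tree G connected = mk⇔
  (λ ((D , W) , _) → connected , width≤1⇒acyclic D W)
  (λ tree → (treeDecomposition tree , treeDecomposition-width tree) ,
            λ D _ W → width≥1 D (fromℕ< (proj₁ connected)) W)

-- The decomposition with bags {u}, V ∖ {u, v}, {v} along the path left — centre — right

pattern left   = zero
pattern centre = suc zero
pattern right  = suc (suc zero)

pattern leftLink  = zero
pattern rightLink = suc zero

path₃ : MultiGraph
path₃ = record
  { n        = 3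
  ; m        = 2
  ; ends     = λ { leftLink → left , centre ; rightLink → centre , right }
  ; loopless = λ { leftLink () ; rightLink () }
  }

path₃-simple : Simple path₃
path₃-simple leftLink  leftLink  _ _ _          _          = refl
path₃-simple rightLink rightLink _ _ _          _          = refl
path₃-simple leftLink  rightLink _ _ (inj₁ refl) (inj₁ ())
path₃-simple leftLink  rightLink _ _ (inj₁ refl) (inj₂ ())
path₃-simple leftLink  rightLink _ _ (inj₂ refl) (inj₁ ())
path₃-simple leftLink  rightLink _ _ (inj₂ refl) (inj₂ ())
path₃-simple rightLink leftLink  _ _ (inj₁ refl) (inj₁ ())
path₃-simple rightLink leftLink  _ _ (inj₁ refl) (inj₂ ())
path₃-simple rightLink leftLink  _ _ (inj₂ refl) (inj₁ ())
path₃-simple rightLink leftLink  _ _ (inj₂ refl) (inj₂ ())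

reach-off-left : ∀ {okE okV} → okE rightLink → (∀ {p} → p ≢ left → okV p) →
                 ∀ {p q} → p ≢ left → q ≢ left → Reach path₃ okE okV p q
reach-off-left _  _  {left}            p≢ _  = ⊥-elim (p≢ refl)
reach-off-left _  _  {_}      {left}   _  q≢ = ⊥-elim (q≢ refl)
reach-off-left _  ok {centre} {centre} p≢ _  = here (ok p≢)
reach-off-left ok ok′ {centre} {right} p≢ q≢ = reach-edge ok (inj₁ refl) (ok′ p≢) (ok′ q≢)
reach-off-left ok ok′ {right} {centre} p≢ q≢ = reach-edge ok (inj₂ refl) (ok′ p≢) (ok′ q≢)
reach-off-left _  ok {right}  {right}  p≢ _  = here (ok p≢)

reach-off-right : ∀ {okE okV} → okE leftLink → (∀ {p} → p ≢ right → okV p) →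
                  ∀ {p q} → p ≢ right → q ≢ right → Reach path₃ okE okV p q
reach-off-right _  _  {right}           p≢ _  = ⊥-elim (p≢ refl)
reach-off-right _  _  {_}      {right}  _  q≢ = ⊥-elim (q≢ refl)
reach-off-right _  ok {left}   {left}   p≢ _  = here (ok p≢)
reach-off-right ok ok′ {left} {centre}  p≢ q≢ = reach-edge ok (inj₁ refl) (ok′ p≢) (ok′ q≢)
reach-off-right ok ok′ {centre} {left}  p≢ q≢ = reach-edge ok (inj₂ refl) (ok′ p≢) (ok′ q≢)
reach-off-right _  ok {centre} {centre} p≢ _  = here (ok p≢)

path₃-tree : IsTree path₃
path₃-tree = (s≤s z≤n , λ p q → reach-trans (to-centre p) (reach-sym (to-centre q))) , acyclic
  where
  to-centre : ∀ p → Reach path₃ (AllE path₃) (AllV path₃) p centre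
  to-centre left   = reach-edge {e = leftLink} tt (inj₁ refl) tt tt
  to-centre centre = here tt
  to-centre right  = reach-edge {e = rightLink} tt (inj₂ refl) tt tt

  -- With two edges, a cycle has length 2, i.e. is a pair of parallel edges.
  acyclic : Acyclic path₃
  acyclic record { len = len ; es = es ; es-inj = es-inj ; joins = joins ; closing = closing }
    with injective⇒≤ (λ {i} {j} → es-inj i j)
  ... | s≤s (s≤s z≤n) with es-inj zero (suc zero) (path₃-simple _ _ _ _ (joins zero) (joins-sym {path₃} closing))
  ...   | ()

module Split (G : MultiGraph) (u v : Fin (n G)) where

  bagOf : Fin (n G) → Fin 3
  bagOf w with w ≟ u | w ≟ v
  ... | yes _ | _     = left
  ... | no _  | yes _ = right
  ... | no _  | no _  = centre

  data Placement (w : Fin (n G)) : Fin 3 → Set where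
    at-left   : w ≡ u → Placement w left
    at-right  : w ≡ v → Placement w right
    at-centre : w ≢ u → w ≢ v → Placement w centre

  placement : ∀ w → Placement w (bagOf w)
  placement w with w ≟ u | w ≟ v
  ... | yes w≡u | _       = at-left w≡u
  ... | no _    | yes w≡v = at-right w≡v
  ... | no w≢u  | no w≢v  = at-centre w≢u w≢v

  bagOf≡left : ∀ {w} → bagOf w ≡ left → w ≡ u
  bagOf≡left {w} eq with subst (Placement w) eq (placement w)
  ... | at-left w≡u = w≡u

  bagOf≡right : ∀ {w} → bagOf w ≡ right → w ≡ v
  bagOf≡right {w} eq with subst (Placement w) eq (placement w)
  ... | at-right w≡v = w≡v

  bagOf≡centre : ∀ {w} → bagOf w ≡ centre → w ≢ u × w ≢ v
  bagOf≡centre {w} eq with subst (Placement w) eq (placement w)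
  ... | at-centre w≢u w≢v = w≢u , w≢v

  bagOf≢centre : ∀ {w} → bagOf w ≢ centre → w ≡ u ⊎ w ≡ v
  bagOf≢centre {w} off with bagOf w | placement w
  ... | _ | at-left w≡u     = inj₁ w≡u
  ... | _ | at-right w≡v    = inj₂ w≡v
  ... | _ | at-centre _ _   = ⊥-elim (off refl)

  decomposition : TCD G
  decomposition = record { T = path₃ ; T-tree = path₃-tree ; bag = bagOf }

  link-adhesion⇒incident : ∀ {l b x} → (∀ {p q} → p ≢ b → q ≢ b → Reach path₃ (_≢ l) (AllV path₃) p q) →
                           (∀ {w} → bagOf w ≡ b → w ≡ x) → ∀ {e} → InAdhLink decomposition l e → Incident G x e
  link-adhesion⇒incident {x = x} connect only-x {e} adh with proj₁ (ends G e) ≟ x | proj₂ (ends G e) ≟ x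
  ... | yes a≡x | _       = endpoint⇒incident {G} (inj₁ a≡x)
  ... | no _    | yes c≡x = endpoint⇒incident {G} (inj₂ c≡x)
  ... | no a≢x  | no c≢x  = ⊥-elim (adh (connect (a≢x ∘ only-x) (c≢x ∘ only-x)))

  node-adhesion-empty : ∀ {b} → (∀ {p q} → p ≢ b → q ≢ b → Reach path₃ (AllE path₃) (_≢ b) p q) →
                        ∀ {e} → ¬ InAdhNode decomposition b e
  node-adhesion-empty connect (a≢b , c≢b , ¬r) = ¬r (connect a≢b c≢b)

  centre-adhesion⇒joins : ∀ {e} → InAdhNode decomposition centre e → Joins G e u v
  centre-adhesion⇒joins {e} (a-off , c-off , _) with bagOf≢centre a-off | bagOf≢centre c-off
  ... | inj₁ a≡u | inj₂ c≡v = inj₁ (cong₂ _,_ a≡u c≡v)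
  ... | inj₂ a≡v | inj₁ c≡u = inj₂ (cong₂ _,_ a≡v c≡u)
  ... | inj₁ a≡u | inj₁ c≡u = ⊥-elim (loopless G e (trans a≡u (sym c≡u)))
  ... | inj₂ a≡v | inj₂ c≡v = ⊥-elim (loopless G e (trans a≡v (sym c≡v)))

  split-width : ∀ {K} → 1 ≤ K →
    (∀ {es} → Unique es → All (Incident G u) es → length es ≤ K) →
    (∀ {es} → Unique es → All (Incident G v) es → length es ≤ K) →
    (∀ {vs es} → Unique vs → All (_≢ u) vs → All (_≢ v) vs →
                 Unique es → All (λ e → Joins G e u v) es → length vs + length es ≤ K) →
    WidthLE decomposition K
  split-width {K} 1≤K incident-u incident-v centre-bound = links , nodes
    where
    links : ∀ l es → Unique es → All (InAdhLink decomposition l) es → length es ≤ K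
    links leftLink  _ ues adh =
      incident-u ues (All.map (link-adhesion⇒incident (reach-off-left (λ ()) _) bagOf≡left) adh)
    links rightLink _ ues adh =
      incident-v ues (All.map (link-adhesion⇒incident (reach-off-right (λ ()) _) bagOf≡right) adh)

    single : ∀ {x vs} → Unique vs → All (_≡ x) vs → length vs ≤ K
    single uvs all-x = ≤-trans (length-unique-subsingleton≤1 (λ p q → trans p (sym q)) uvs all-x) 1≤K

    nodes : ∀ b vs es → Unique vs → All (λ w → bagOf w ≡ b) vs →
            Unique es → All (InAdhNode decomposition b) es → length vs + length es ≤ K
    nodes left vs _ uvs in-b _ adh =
      ≤-+[] {xs = vs} (single uvs (All.map bagOf≡left in-b))
                      (all-absurd⇒[] (node-adhesion-empty (reach-off-left tt id)) adh)
    nodes right vs _ uvs in-b _ adh =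
      ≤-+[] {xs = vs} (single uvs (All.map bagOf≡right in-b))
                      (all-absurd⇒[] (node-adhesion-empty (reach-off-right tt id)) adh)
    nodes centre _ _ uvs in-b ues adh =
      centre-bound uvs (All.map (proj₁ ∘ bagOf≡centre) in-b) (All.map (proj₂ ∘ bagOf≡centre) in-b)
                   ues (All.map centre-adhesion⇒joins adh)

∸2+1≡∸1 : ∀ {N} → 2 ≤ N → N ∸ 2 + 1 ≡ N ∸ 1
∸2+1≡∸1 (s≤s (s≤s {n = k} _)) = +-comm k 1

module _ {G : MultiGraph} (simple : Simple G) where

  incident-edges≤neighbours : ∀ {u K} → (∀ {ws} → Unique ws → All (Adjacent G u) ws → length ws ≤ K) →
                              ∀ {es} → Unique es → All (Incident G u) es → length es ≤ K
  incident-edges≤neighbours {u} neighbours ues incident =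
    subst (_≤ _) (length-reduce proj₁ incident)
      (neighbours (reduce-unique proj₁ same-neighbour ues incident)
                  (reduce-All proj₁ (λ {e} (_ , j) → e , j) incident))
    where
    same-neighbour : ∀ {e e′} (i : Incident G u e) (i′ : Incident G u e′) → proj₁ i ≡ proj₁ i′ → e ≡ e′
    same-neighbour (w , j) (_ , j′) refl = simple _ _ u w j j′

  parallel-edges≤1 : ∀ {u v es} → Unique es → All (λ e → Joins G e u v) es → length es ≤ 1
  parallel-edges≤1 = length-unique-subsingleton≤1 (simple _ _ _ _)

  split-width≤n∸1 : 2 ≤ n G → ∀ {u v} → u ≢ v → WidthLE (Split.decomposition G u v) (n G ∸ 1)
  split-width≤n∸1 2≤n {u} {v} u≢v =
    Split.split-width G u v (m<n⇒0<n∸m 2≤n) degree≤ degree≤ centre-bound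
    where
    degree≤ : ∀ {x es} → Unique es → All (Incident G x) es → length es ≤ n G ∸ 1
    degree≤ = incident-edges≤neighbours λ uws adjacent →
      length-unique-avoiding≤ uws (All.map (adjacent⇒≢ {G}) adjacent)

    centre-bound : ∀ {vs es} → Unique vs → All (_≢ u) vs → All (_≢ v) vs →
                   Unique es → All (λ e → Joins G e u v) es → length vs + length es ≤ n G ∸ 1
    centre-bound {vs} {es} uvs ≢u ≢v ues uv-edges =
      subst (length vs + length es ≤_) (∸2+1≡∸1 2≤n)
            (+-mono-≤ (length-unique-avoiding₂≤ u≢v uvs ≢u ≢v) (parallel-edges≤1 ues uv-edges))

  nonadjacent-split-width≤n∸2 : 3 ≤ n G → ∀ {u v} → u ≢ v → ¬ Adjacent G u v →
                                WidthLE (Split.decomposition G u v) (n G ∸ 2)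
  nonadjacent-split-width≤n∸2 3≤n {u} {v} u≢v ¬adjacent =
    Split.split-width G u v (m<n⇒0<n∸m 3≤n)
      (degree≤ u≢v ¬adjacent) (degree≤ (u≢v ∘ sym) (¬adjacent ∘ adjacent-sym {G})) centre-bound
    where
    degree≤ : ∀ {x y} → x ≢ y → ¬ Adjacent G x y →
              ∀ {es} → Unique es → All (Incident G x) es → length es ≤ n G ∸ 2
    degree≤ x≢y ¬adj = incident-edges≤neighbours λ uws adjacent →
      length-unique-avoiding₂≤ x≢y uws (All.map (adjacent⇒≢ {G}) adjacent)
                                       (All.map (λ { adj refl → ¬adj adj }) adjacent)

    centre-bound : ∀ {vs es} → Unique vs → All (_≢ u) vs → All (_≢ v) vs →
                   Unique es → All (λ e → Joins G e u v) es → length vs + length es ≤ n G ∸ 2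
    centre-bound {vs} uvs ≢u ≢v _ uv-edges =
      ≤-+[] {xs = vs} (length-unique-avoiding₂≤ u≢v uvs ≢u ≢v)
                      (all-absurd⇒[] (λ j → ¬adjacent (_ , j)) uv-edges)

adjacent-in-small-graph : ∀ {G u v} → Connected G → ¬ 3 ≤ n G → u ≢ v → Adjacent G u v
adjacent-in-small-graph {G} {u} {v} (_ , connected) 3≰n u≢v = last-edge (connected u v)
  where
  last-edge : Reach G (AllE G) (AllV G) u v → Adjacent G u v
  last-edge (here _)         = ⊥-elim (u≢v refl)
  last-edge (step e _ _ j _) =
    e , subst (λ y → Joins G e y v) (at-most-two-elements 3≰n (joins-irrefl {G} j) u≢v) j

-- Complete graphs

module Crossing {G : MultiGraph} (complete : IsComplete G) (D : TCD G)
                {l : Fin (m (T D))} {u v : Fin (n G)} (¬same : ¬ SameSide D l u v) where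

  record CrossingEdge (w : Fin (n G)) : Set where
    constructor crossingEdge
    field
      crossing : Fin (m G)
      partner  : Fin (n G)
      w≢u      : w ≢ u
      partner∈ : partner ≡ u ⊎ partner ≡ v
      joins    : Joins G crossing w partner
      crosses  : InAdhLink D l crossing

  open CrossingEdge

  -- w is adjacent to u and to v, which lie on different sides of l, so one of the two edges crosses l.
  crossing-edge : ∀ w → w ≢ u → ¬ ¬ CrossingEdge w
  crossing-edge w w≢u none with complete w u w≢u
  ... | wu , wu-joins =
    ¬adhesion⇒¬¬sameSide D wu-joins (none ∘ crossingEdge wu u w≢u (inj₁ refl) wu-joins) via-v
    where
    via-v : ¬ SameSide D l w u
    via-v w~u with w ≟ v
    ... | yes refl = ¬same (reach-sym w~u)
    ... | no w≢v with complete w v w≢v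
    ...   | wv , wv-joins =
      ¬adhesion⇒¬¬sameSide D wv-joins (none ∘ crossingEdge wv v w≢u (inj₂ refl) wv-joins)
                                      (¬same ∘ reach-trans (reach-sym w~u))

  shared-crossing⇒v : ∀ {w w′} (c : CrossingEdge w) (c′ : CrossingEdge w′) →
                      crossing c ≡ crossing c′ → w ≡ w′ ⊎ w ≡ v
  shared-crossing⇒v c c′ eq with joins-end {G} (joins c) (subst (λ e → Joins G e _ _) (sym eq) (joins c′))
  ... | inj₁ w≡w′ = inj₁ w≡w′
  ... | inj₂ w≡p′ = inj₂ ([ (λ p′≡u → ⊥-elim (w≢u c (trans w≡p′ p′≡u))) , trans w≡p′ ] (partner∈ c′))

  crossing-injective : ∀ {w w′} (c : CrossingEdge w) (c′ : CrossingEdge w′) →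
                       crossing c ≡ crossing c′ → w ≡ w′
  crossing-injective c c′ eq with shared-crossing⇒v c c′ eq | shared-crossing⇒v c′ c (sym eq)
  ... | inj₁ w≡w′ | _          = w≡w′
  ... | inj₂ _    | inj₁ w′≡w  = sym w′≡w
  ... | inj₂ w≡v  | inj₂ w′≡v  = trans w≡v (sym w′≡v)

  width≥n∸1 : ∀ {j} → WidthLE D j → n G ∸ 1 ≤ j
  width≥n∸1 {j} W with allFinExcept u
  ... | others , unique , others≢u , |others| =
    decidable-stable (n G ∸ 1 ≤? j)
      (¬¬-map count (All.mapM 0ℓ ¬¬-Monad (λ {w} → crossing-edge w) others≢u))
    where
    count : All CrossingEdge others → n G ∸ 1 ≤ j
    count cs = subst (_≤ j) (trans (length-reduce crossing cs) |others|)
      (proj₁ W l _ (reduce-unique crossing crossing-injective unique cs) (reduce-All crossing crosses cs))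

complete-width≥n∸1 : ∀ {G} → IsComplete G → (D : TCD G) → Fin (n G) → ∀ {j} → WidthLE D j → n G ∸ 1 ≤ j
complete-width≥n∸1 {G} complete D u {j} W with all? (λ w → bag D w ≟ bag D u)
... | yes one-bag =
  ≤-trans (m∸n≤m (n G) 1)
          (subst (_≤ j) (length-tabulate id) (bag-size≤width D W (UniqueP.allFin⁺ _) (AllP.tabulate⁺ one-bag)))
... | no ¬one-bag with ¬∀⟶∃¬ _ _ (λ w → bag D w ≟ bag D u) ¬one-bag
...   | v , v-elsewhere with tree-separating-link (T-tree D) (v-elsewhere ∘ sym)
...     | _ , ¬same = Crossing.width≥n∸1 complete D ¬same W

scw≡n∸1⇔complete : ∀ (G : MultiGraph) → Connected G → Simple G → 2 ≤ n G →
                    (IsScw G (n G ∸ 1) ⇔ IsComplete G)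
scw≡n∸1⇔complete G connected simple 2≤n = mk⇔ scw⇒complete complete⇒scw
  where
  u₀ u₁ : Fin (n G)
  u₀ = fromℕ< {0} (≤-trans (s≤s z≤n) 2≤n)
  u₁ = fromℕ< {1} 2≤n

  complete⇒scw : IsComplete G → IsScw G (n G ∸ 1)
  complete⇒scw complete =
    (Split.decomposition G u₀ u₁ , split-width≤n∸1 simple 2≤n (λ eq → case fromℕ<-injective 0 1 _ _ eq of λ ())) ,
    λ D _ → complete-width≥n∸1 complete D u₀

  scw⇒complete : IsScw G (n G ∸ 1) → IsComplete G
  scw⇒complete (_ , minimal) u v u≢v = decidable-stable (adjacent? G u v) λ ¬adjacent →
    case 3 ≤? n G of λ where
      (yes 3≤n) → <⇒≱ (∸-monoʳ-< (s≤s (s≤s z≤n)) 2≤n)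
                      (minimal (Split.decomposition G u v) _ (nonadjacent-split-width≤n∸2 simple 3≤n u≢v ¬adjacent))
      (no 3≰n)  → ¬adjacent (adjacent-in-small-graph {G} connected 3≰n u≢v)

mainTheorem9 : (∀ (G : MultiGraph) → Connected G → (IsScw G 1 ⇔ IsTree G)) ×
    (∀ (G : MultiGraph) → Connected G → Simple G → 2 ≤ n G →
       (IsScw G (n G ∸ 1) ⇔ IsComplete G))
mainTheorem9 = scw≡1⇔tree , scw≡n∸1⇔complete
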